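{- Let $N$ be a positive integer. Among all rooted binary trees $(T,r)$ with $N$ vertices, the number $F_T(r)$ of subtrees of $T$ containing $r$ is minimized by the rooted binary caterpillar with $N$ vertices (rooted at its root).
   Context: A rooted binary tree is a tree $T$ with a designated vertex $r$ (the root) such that either $T$ consists of $r$ alone, or $r$ has degree $2$ and every other vertex has degree $1$ or $3$. A binary caterpillar is a tree in which every non-leaf vertex has degree $3$ and the non-leaf vertices induce a path. A rooted binary caterpillar is a rooted binary tree $(T,r)$ which is either a single vertex, or in which the vertices of degree at least $2$ induce a path having $r$ as an end vertex; equivalently, deleting a leaf neighbor of $r$ yields a binary caterpillar. $F_T(v)$ denotes the number of subtrees of $T$ containing $v$. -}

module Defs where

open import Data.Nat using (ℕ; zero; suc)
open import Data.Bool using (Bool; true; false; _∧_; if_then_else_)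
open import Data.List using (List; []; _∷_; [_]; _++_; map; length)
open import Data.List.Properties using (≡-dec)
open import Relation.Binary.PropositionalEquality using (_≡_; refl)
open import Relation.Binary.Definitions using (DecidableEquality)
open import Relation.Nullary.Decidable using (yes; no; does)

-- Rooted binary trees (T , r): either the root alone, or the root has
-- exactly two children, each of which is again the root of a rooted
-- binary tree (every non-root vertex has degree 1 (leaf) or 3).
data BTree : Set where
  leaf : BTree
  node : BTree → BTree → BTree

-- Vertices are named by addresses: the list of child-directions read
-- from the vertex UP to the root (so the parent of  d ∷ a  is  a,
-- and the root is the empty address).
data Dir : Set where
  L R : Dir

_≟Dir_ : DecidableEquality Dir
L ≟Dir L = yes refl
L ≟Dir R = no (λ ())
R ≟Dir L = no (λ ())
R ≟Dir R = yes refl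

Addr : Set
Addr = List Dir

_≟Addr_ : DecidableEquality Addr
_≟Addr_ = ≡-dec _≟Dir_

vertices : BTree → List Addr
vertices leaf       = [ [] ]
vertices (node l r) = [] ∷ (map (λ a → a ++ [ L ]) (vertices l)
                         ++ map (λ a → a ++ [ R ]) (vertices r))

size : BTree → ℕ
size t = length (vertices t)

sublists : {A : Set} → List A → List (List A)
sublists []       = [ [] ]
sublists (x ∷ xs) = map (x ∷_) (sublists xs) ++ sublists xs

_∈ᵇ_ : Addr → List Addr → Bool
a ∈ᵇ []      = false
a ∈ᵇ (b ∷ s) = does (a ≟Addr b) Data.Bool.∨ (a ∈ᵇ s)

allᵇ : {A : Set} → (A → Bool) → List A → Bool
allᵇ p []       = true
allᵇ p (x ∷ xs) = p x ∧ allᵇ p xs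

-- A vertex set S (a subset of the vertices of T) induces a subtree of T
-- containing the root r iff r ∈ S and S is connected; in a tree, with r ∈ S,
-- connectedness of S is the same as S being closed under taking parents.
parentIn : List Addr → Addr → Bool
parentIn S []      = true
parentIn S (d ∷ a) = a ∈ᵇ S

isRootSubtree : List Addr → Bool
isRootSubtree S = ([] ∈ᵇ S) ∧ allᵇ (parentIn S) S

countᵇ : {A : Set} → (A → Bool) → List A → ℕ
countᵇ p []       = zero
countᵇ p (x ∷ xs) = if p x then suc (countᵇ p xs) else countᵇ p xs

F-root : BTree → ℕ
F-root t = countᵇ isRootSubtree (sublists (vertices t))

-- Rooted binary caterpillar: a single vertex, or the vertices of degree ≥ 2
-- (the internal vertices) induce a path with r as an end vertex; i.e. every
-- internal vertex has at most one internal child (hence a leaf child).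
data IsCaterpillar : BTree → Set where
  cat-leaf  : IsCaterpillar leaf
  cat-left  : ∀ {t} → IsCaterpillar t → IsCaterpillar (node leaf t)
  cat-right : ∀ {t} → IsCaterpillar t → IsCaterpillar (node t leaf)

-- Counting all parent-closed vertex sets, the empty one included,
-- gives C(T) = F_T(r) + 1, and C(leaf) = 2, C(node l r) = C(l) C(r) + 1: a closed
-- set is either empty or the root together with closed sets of both subtrees.
-- A tree with N vertices has k = (N - 1)/2 internal vertices; caterpillars
-- realise c(k), where c(0) = 2 and c(k + 1) = 2 c(k) + 1, and since
-- 2 c(a + b) ≤ c(a) c(b) the recursion shows C(T) ≥ c(k) for every T.
module Submission where

open import Defs
open import Data.Bool using (Bool; true; false; _∧_; _∨_; if_then_else_)
open import Data.Bool.Properties using (∨-identityʳ)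
open import Data.List using (List; []; _∷_; [_]; _++_; map; length; null)
open import Data.List.Properties using (map-++; map-∘; length-++; length-map; ∷ʳ-injectiveˡ; ∷ʳ-injectiveʳ)
open import Data.List.Relation.Unary.All as All using (All; []; _∷_)
open import Data.List.Relation.Unary.All.Properties using (++⁺; map⁺)
open import Data.Nat using (ℕ; zero; suc; _+_; _*_; _≤_; s≤s; s≤s⁻¹)
open import Data.Nat.Properties
open import Data.Nat.Tactic.RingSolver using (solve-∀)
open import Data.Product using (Σ; _×_; _,_)
open import Function using (_∘_)
open import Relation.Binary.PropositionalEquality using (_≡_; _≢_; refl; sym; trans; cong; cong₂; module ≡-Reasoning)
open import Relation.Nullary using (yes; no)
open import Relation.Nullary.Decidable using (does; dec-true; dec-false)

private
  variable
    A B C : Set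

countᵇ-++ : (p : A → Bool) (xs ys : List A) → countᵇ p (xs ++ ys) ≡ countᵇ p xs + countᵇ p ys
countᵇ-++ p []       ys = refl
countᵇ-++ p (x ∷ xs) ys with p x
... | true  = cong suc (countᵇ-++ p xs ys)
... | false = countᵇ-++ p xs ys

countᵇ-map : (p : B → Bool) (f : A → B) (xs : List A) → countᵇ p (map f xs) ≡ countᵇ (p ∘ f) xs
countᵇ-map p f []       = refl
countᵇ-map p f (x ∷ xs) with p (f x)
... | true  = cong suc (countᵇ-map p f xs)
... | false = countᵇ-map p f xs

countᵇ-cong : {p q : A → Bool} {xs : List A} → All (λ x → p x ≡ q x) xs → countᵇ p xs ≡ countᵇ q xs
countᵇ-cong [] = refl
countᵇ-cong {p = p} {q} {x ∷ xs} (_ ∷ eqs) with p x | q x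
countᵇ-cong (refl ∷ eqs) | true  | true  = cong suc (countᵇ-cong eqs)
countᵇ-cong (refl ∷ eqs) | false | false = countᵇ-cong eqs

countᵇ-false : (xs : List A) → countᵇ (λ _ → false) xs ≡ 0
countᵇ-false []       = refl
countᵇ-false (x ∷ xs) = countᵇ-false xs

countᵇ-const-∧ : (b : Bool) (r : A → Bool) (xs : List A) →
  countᵇ (λ x → b ∧ r x) xs ≡ (if b then 1 else 0) * countᵇ r xs
countᵇ-const-∧ true  r xs = sym (+-identityʳ (countᵇ r xs))
countᵇ-const-∧ false r xs = countᵇ-false xs

sublists-map : (f : A → B) (xs : List A) → sublists (map f xs) ≡ map (map f) (sublists xs)
sublists-map f []       = refl
sublists-map f (x ∷ xs) = begin
    map (f x ∷_) (sublists (map f xs)) ++ sublists (map f xs)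
  ≡⟨ cong (λ ss → map (f x ∷_) ss ++ ss) (sublists-map f xs) ⟩
    map (f x ∷_) (map (map f) (sublists xs)) ++ map (map f) (sublists xs)
  ≡⟨ cong (_++ map (map f) (sublists xs)) (trans (sym (map-∘ (sublists xs))) (map-∘ (sublists xs))) ⟩
    map (map f) (map (x ∷_) (sublists xs)) ++ map (map f) (sublists xs)
  ≡⟨ sym (map-++ (map f) (map (x ∷_) (sublists xs)) (sublists xs)) ⟩
    map (map f) (map (x ∷_) (sublists xs) ++ sublists xs)
  ∎
  where open ≡-Reasoning

All-sublists : {P : A → Set} {xs : List A} → All P xs → All (All P) (sublists xs)
All-sublists []         = [] ∷ []
All-sublists (px ∷ pxs) = ++⁺ (map⁺ (All.map (px ∷_) ih)) ih
  where ih = All-sublists pxs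

countᵇ-null-sublists : (xs : List A) → countᵇ null (sublists xs) ≡ 1
countᵇ-null-sublists []       = refl
countᵇ-null-sublists (x ∷ xs) = begin
    countᵇ null (map (x ∷_) (sublists xs) ++ sublists xs)
  ≡⟨ countᵇ-++ null (map (x ∷_) (sublists xs)) (sublists xs) ⟩
    countᵇ null (map (x ∷_) (sublists xs)) + countᵇ null (sublists xs)
  ≡⟨ cong₂ _+_ (trans (countᵇ-map null (x ∷_) (sublists xs)) (countᵇ-false (sublists xs)))
               (countᵇ-null-sublists xs) ⟩
    1
  ∎
  where open ≡-Reasoning

-- Choosing a sublist of  map f xs ++ map g ys  is choosing one of each part, so a
-- predicate that splits as a conjunction is counted by a product.
countᵇ-sublists-++ : (p : List C → Bool) (q : List A → Bool) (r : List B → Bool) (f : A → C) (g : B → C) →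
  (∀ a b → p (map f a ++ map g b) ≡ q a ∧ r b) →
  (xs : List A) (ys : List B) →
  countᵇ p (sublists (map f xs ++ map g ys)) ≡ countᵇ q (sublists xs) * countᵇ r (sublists ys)
countᵇ-sublists-++ p q r f g split [] ys = begin
    countᵇ p (sublists (map g ys))
  ≡⟨ cong (countᵇ p) (sublists-map g ys) ⟩
    countᵇ p (map (map g) (sublists ys))
  ≡⟨ countᵇ-map p (map g) (sublists ys) ⟩
    countᵇ (p ∘ map g) (sublists ys)
  ≡⟨ countᵇ-cong (All.universal (split []) (sublists ys)) ⟩
    countᵇ (λ b → q [] ∧ r b) (sublists ys)
  ≡⟨ countᵇ-const-∧ (q []) r (sublists ys) ⟩
    (if q [] then 1 else 0) * countᵇ r (sublists ys)
  ∎
  where open ≡-Reasoning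
countᵇ-sublists-++ p q r f g split (x ∷ xs) ys = begin
    countᵇ p (map (f x ∷_) S ++ S)
  ≡⟨ countᵇ-++ p (map (f x ∷_) S) S ⟩
    countᵇ p (map (f x ∷_) S) + countᵇ p S
  ≡⟨ cong (_+ countᵇ p S) (countᵇ-map p (f x ∷_) S) ⟩
    countᵇ (p ∘ (f x ∷_)) S + countᵇ p S
  ≡⟨ cong₂ _+_ (countᵇ-sublists-++ (p ∘ (f x ∷_)) (q ∘ (x ∷_)) r f g (λ a → split (x ∷ a)) xs ys)
               (countᵇ-sublists-++ p q r f g split xs ys) ⟩
    countᵇ (q ∘ (x ∷_)) Sx * n + countᵇ q Sx * n
  ≡⟨ sym (*-distribʳ-+ n (countᵇ (q ∘ (x ∷_)) Sx) (countᵇ q Sx)) ⟩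
    (countᵇ (q ∘ (x ∷_)) Sx + countᵇ q Sx) * n
  ≡⟨ cong (λ m → (m + countᵇ q Sx) * n) (sym (countᵇ-map q (x ∷_) Sx)) ⟩
    (countᵇ q (map (x ∷_) Sx) + countᵇ q Sx) * n
  ≡⟨ cong (_* n) (sym (countᵇ-++ q (map (x ∷_) Sx) Sx)) ⟩
    countᵇ q (map (x ∷_) Sx ++ Sx) * n
  ∎
  where
  open ≡-Reasoning
  S  = sublists (map f xs ++ map g ys)
  Sx = sublists xs
  n  = countᵇ r (sublists ys)

allᵇ-++ : (p : A → Bool) (xs ys : List A) → allᵇ p (xs ++ ys) ≡ allᵇ p xs ∧ allᵇ p ys
allᵇ-++ p []       ys = refl
allᵇ-++ p (x ∷ xs) ys with p x
... | true  = allᵇ-++ p xs ys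
... | false = refl

allᵇ-map : (p : B → Bool) (f : A → B) (xs : List A) → allᵇ p (map f xs) ≡ allᵇ (p ∘ f) xs
allᵇ-map p f []       = refl
allᵇ-map p f (x ∷ xs) = cong (p (f x) ∧_) (allᵇ-map p f xs)

allᵇ-cong : {p q : A → Bool} → (∀ x → p x ≡ q x) → (xs : List A) → allᵇ p xs ≡ allᵇ q xs
allᵇ-cong eq []       = refl
allᵇ-cong eq (x ∷ xs) = cong₂ _∧_ (eq x) (allᵇ-cong eq xs)

∈ᵇ-++ : (a : Addr) (xs ys : List Addr) → a ∈ᵇ (xs ++ ys) ≡ a ∈ᵇ xs ∨ a ∈ᵇ ys
∈ᵇ-++ a []       ys = refl
∈ᵇ-++ a (x ∷ xs) ys with does (a ≟Addr x)
... | true  = refl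
... | false = ∈ᵇ-++ a xs ys

allᵇ-∈ᵇ : (p : Addr → Bool) {S : List Addr} {a : Addr} → allᵇ p S ≡ true → a ∈ᵇ S ≡ true → p a ≡ true
allᵇ-∈ᵇ p {b ∷ S} {a} all∈ a∈ with a ≟Addr b | p b in pb
... | yes refl | true = pb
... | no _     | true = allᵇ-∈ᵇ p {S} all∈ a∈

∈ᵇ-self : (a : Addr) (S : List Addr) → a ∈ᵇ (a ∷ S) ≡ true
∈ᵇ-self a S = cong (_∨ a ∈ᵇ S) (dec-true (a ≟Addr a) refl)

child : Dir → Addr → Addr
child d a = a ++ [ d ]

children : List Addr → List Addr → List Addr
children A B = map (child L) A ++ map (child R) B

branch : Dir → List Addr → List Addr → List Addr
branch L A B = A
branch R A B = B

child≢root : (d : Dir) (a : Addr) → child d a ≢ []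
child≢root d []      ()
child≢root d (_ ∷ _) ()

child-∈ᵇ-map-child : (d : Dir) (a : Addr) (X : List Addr) → child d a ∈ᵇ map (child d) X ≡ a ∈ᵇ X
child-∈ᵇ-map-child d a []      = refl
child-∈ᵇ-map-child d a (x ∷ X) = cong₂ _∨_ same-does (child-∈ᵇ-map-child d a X)
  where
  same-does : does (child d a ≟Addr child d x) ≡ does (a ≟Addr x)
  same-does with a ≟Addr x
  ... | yes refl = dec-true (child d a ≟Addr child d a) refl
  ... | no a≢x   = dec-false (child d a ≟Addr child d x) (a≢x ∘ ∷ʳ-injectiveˡ a x)

child-∉ᵇ-map-child : {d e : Dir} → d ≢ e → (a : Addr) (X : List Addr) → child d a ∈ᵇ map (child e) X ≡ false
child-∉ᵇ-map-child d≢e a []      = refl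
child-∉ᵇ-map-child d≢e a (x ∷ X) =
  cong₂ _∨_ (dec-false (child _ a ≟Addr child _ x) (d≢e ∘ ∷ʳ-injectiveʳ a x)) (child-∉ᵇ-map-child d≢e a X)

child-∈ᵇ-children : (d : Dir) (a : Addr) (A B : List Addr) → child d a ∈ᵇ children A B ≡ a ∈ᵇ branch d A B
child-∈ᵇ-children d a A B = trans (∈ᵇ-++ (child d a) (map (child L) A) (map (child R) B)) (by-branch d)
  where
  by-branch : (d : Dir) → child d a ∈ᵇ map (child L) A ∨ child d a ∈ᵇ map (child R) B ≡ a ∈ᵇ branch d A B
  by-branch L = trans (cong₂ _∨_ (child-∈ᵇ-map-child L a A) (child-∉ᵇ-map-child (λ ()) a B)) (∨-identityʳ _)
  by-branch R = cong₂ _∨_ (child-∉ᵇ-map-child (λ ()) a A) (child-∈ᵇ-map-child R a B)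

parentIn-child : (d : Dir) (A B : List Addr) (a : Addr) →
  parentIn ([] ∷ children A B) (child d a) ≡ parentIn (branch d A B) a
parentIn-child d A B []      = refl
parentIn-child d A B (_ ∷ a) =
  trans (cong (_∨ child d a ∈ᵇ children A B) (dec-false (child d a ≟Addr []) (child≢root d a)))
        (child-∈ᵇ-children d a A B)

parentClosed : List Addr → Bool
parentClosed S = allᵇ (parentIn S) S

parentClosed-root∷children : (A B : List Addr) → parentClosed ([] ∷ children A B) ≡ parentClosed A ∧ parentClosed B
parentClosed-root∷children A B = begin
    allᵇ P (map (child L) A ++ map (child R) B)
  ≡⟨ allᵇ-++ P (map (child L) A) (map (child R) B) ⟩
    allᵇ P (map (child L) A) ∧ allᵇ P (map (child R) B)
  ≡⟨ cong₂ _∧_ (trans (allᵇ-map P (child L) A) (allᵇ-cong (parentIn-child L A B) A))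
               (trans (allᵇ-map P (child R) B) (allᵇ-cong (parentIn-child R A B) B)) ⟩
    parentClosed A ∧ parentClosed B
  ∎
  where
  open ≡-Reasoning
  P = parentIn ([] ∷ children A B)

parentClosed-∋-root : (S : List Addr) (a : Addr) → parentClosed S ≡ true → a ∈ᵇ S ≡ true → [] ∈ᵇ S ≡ true
parentClosed-∋-root S []      closed a∈ = a∈
parentClosed-∋-root S (d ∷ a) closed a∈ = parentClosed-∋-root S a closed (allᵇ-∈ᵇ (parentIn S) {S} closed a∈)

root-∉ᵇ : {S : List Addr} → All (_≢ []) S → [] ∈ᵇ S ≡ false
root-∉ᵇ []                      = refl
root-∉ᵇ {a ∷ S} (a≢[] ∷ S≢[]) = cong₂ _∨_ (dec-false ([] ≟Addr a) (a≢[] ∘ sym)) (root-∉ᵇ S≢[])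

-- a nonempty parent-closed set contains the root
parentClosed-rootless : {S : List Addr} → All (_≢ []) S → parentClosed S ≡ null S
parentClosed-rootless {[]}    _    = refl
parentClosed-rootless {a ∷ S} S≢[] with parentClosed (a ∷ S) in closed
... | false = refl
... | true  with () ← trans (sym (parentClosed-∋-root (a ∷ S) a closed (∈ᵇ-self a S))) (root-∉ᵇ S≢[])

children≢root : (A B : List Addr) → All (_≢ []) (children A B)
children≢root A B = ++⁺ (map⁺ (All.universal (child≢root L) A)) (map⁺ (All.universal (child≢root R) B))

closedCount : BTree → ℕ
closedCount t = countᵇ parentClosed (sublists (vertices t))

countᵇ-root∷children : (l r : BTree) →
  countᵇ (parentClosed ∘ ([] ∷_)) (sublists (children (vertices l) (vertices r))) ≡ closedCount l * closedCount r
countᵇ-root∷children l r =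
  countᵇ-sublists-++ _ parentClosed parentClosed (child L) (child R) parentClosed-root∷children (vertices l) (vertices r)

F-root-node : (l r : BTree) → F-root (node l r) ≡ closedCount l * closedCount r
F-root-node l r = begin
    countᵇ isRootSubtree (map ([] ∷_) S ++ S)
  ≡⟨ countᵇ-++ isRootSubtree (map ([] ∷_) S) S ⟩
    countᵇ isRootSubtree (map ([] ∷_) S) + countᵇ isRootSubtree S
  ≡⟨ cong₂ _+_ (trans (countᵇ-map isRootSubtree ([] ∷_) S) (countᵇ-root∷children l r))
               (trans (countᵇ-cong (All.map (λ {S} S≢[] → cong (_∧ parentClosed S) (root-∉ᵇ S≢[])) (All-sublists K≢[]))) (countᵇ-false S)) ⟩
    closedCount l * closedCount r + 0
  ≡⟨ +-identityʳ _ ⟩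
    closedCount l * closedCount r
  ∎
  where
  open ≡-Reasoning
  K≢[] = children≢root (vertices l) (vertices r)
  S = sublists (children (vertices l) (vertices r))

closedCount-node : (l r : BTree) → closedCount (node l r) ≡ closedCount l * closedCount r + 1
closedCount-node l r = begin
    countᵇ parentClosed (map ([] ∷_) S ++ S)
  ≡⟨ countᵇ-++ parentClosed (map ([] ∷_) S) S ⟩
    countᵇ parentClosed (map ([] ∷_) S) + countᵇ parentClosed S
  ≡⟨ cong₂ _+_ (trans (countᵇ-map parentClosed ([] ∷_) S) (countᵇ-root∷children l r))
               (trans (countᵇ-cong (All.map parentClosed-rootless (All-sublists K≢[])))
                      (countᵇ-null-sublists (children (vertices l) (vertices r)))) ⟩
    closedCount l * closedCount r + 1
  ∎
  where
  open ≡-Reasoning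
  K≢[] = children≢root (vertices l) (vertices r)
  S = sublists (children (vertices l) (vertices r))

closedCount≡suc-F-root : (t : BTree) → closedCount t ≡ suc (F-root t)
closedCount≡suc-F-root leaf       = refl
closedCount≡suc-F-root (node l r) =
  trans (closedCount-node l r) (trans (+-comm _ 1) (cong suc (sym (F-root-node l r))))

internal : BTree → ℕ
internal leaf       = 0
internal (node l r) = suc (internal l + internal r)

size≡1+2*internal : (t : BTree) → size t ≡ suc (2 * internal t)
size≡1+2*internal leaf       = refl
size≡1+2*internal (node l r) = begin
    suc (length (map (child L) (vertices l) ++ map (child R) (vertices r)))
  ≡⟨ cong suc (length-++ (map (child L) (vertices l))) ⟩
    suc (length (map (child L) (vertices l)) + length (map (child R) (vertices r)))
  ≡⟨ cong suc (cong₂ _+_ (length-map (child L) (vertices l)) (length-map (child R) (vertices r))) ⟩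
    suc (size l + size r)
  ≡⟨ cong suc (cong₂ _+_ (size≡1+2*internal l) (size≡1+2*internal r)) ⟩
    suc (suc (2 * internal l) + suc (2 * internal r))
  ≡⟨ cong suc (odd+odd (internal l) (internal r)) ⟩
    suc (2 * internal (node l r))
  ∎
  where
  open ≡-Reasoning
  odd+odd : (a b : ℕ) → suc (2 * a) + suc (2 * b) ≡ 2 * suc (a + b)
  odd+odd = solve-∀

caterpillar : ℕ → BTree
caterpillar zero    = leaf
caterpillar (suc n) = node leaf (caterpillar n)

caterpillar-isCaterpillar : (n : ℕ) → IsCaterpillar (caterpillar n)
caterpillar-isCaterpillar zero    = cat-leaf
caterpillar-isCaterpillar (suc n) = cat-left (caterpillar-isCaterpillar n)

internal-caterpillar : (n : ℕ) → internal (caterpillar n) ≡ n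
internal-caterpillar zero    = refl
internal-caterpillar (suc n) = cong suc (internal-caterpillar n)

size-caterpillar : (n : ℕ) → size (caterpillar n) ≡ suc (2 * n)
size-caterpillar n = trans (size≡1+2*internal (caterpillar n)) (cong (suc ∘ (2 *_)) (internal-caterpillar n))

caterpillarCount : ℕ → ℕ
caterpillarCount zero    = 2
caterpillarCount (suc n) = suc (2 * caterpillarCount n)

closedCount-caterpillar : {c : BTree} → IsCaterpillar c → closedCount c ≡ caterpillarCount (internal c)
closedCount-caterpillar cat-leaf = refl
closedCount-caterpillar (cat-left {t} ct) = begin
    closedCount (node leaf t)
  ≡⟨ closedCount-node leaf t ⟩
    2 * closedCount t + 1
  ≡⟨ +-comm _ 1 ⟩
    suc (2 * closedCount t)
  ≡⟨ cong (suc ∘ (2 *_)) (closedCount-caterpillar ct) ⟩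
    caterpillarCount (internal (node leaf t))
  ∎
  where open ≡-Reasoning
closedCount-caterpillar (cat-right {t} ct) = begin
    closedCount (node t leaf)
  ≡⟨ closedCount-node t leaf ⟩
    closedCount t * 2 + 1
  ≡⟨ trans (+-comm _ 1) (cong suc (*-comm (closedCount t) 2)) ⟩
    suc (2 * closedCount t)
  ≡⟨ cong (suc ∘ (2 *_)) (closedCount-caterpillar ct) ⟩
    caterpillarCount (suc (internal t))
  ≡⟨ cong (caterpillarCount ∘ suc) (sym (+-identityʳ (internal t))) ⟩
    caterpillarCount (internal (node t leaf))
  ∎
  where open ≡-Reasoning

2≤caterpillarCount : (n : ℕ) → 2 ≤ caterpillarCount n
2≤caterpillarCount zero    = ≤-refl
2≤caterpillarCount (suc n) = m≤n⇒m≤1+n (≤-trans (2≤caterpillarCount n) (m≤n*m (caterpillarCount n) 2))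

2*caterpillarCount-+≤* : (m n : ℕ) → 2 * caterpillarCount (m + n) ≤ caterpillarCount m * caterpillarCount n
2*caterpillarCount-+≤* zero    n = ≤-refl
2*caterpillarCount-+≤* (suc m) n = begin
    2 * suc (2 * caterpillarCount (m + n))
  ≡⟨ *-distribˡ-+ 2 1 (2 * caterpillarCount (m + n)) ⟩
    2 + 2 * (2 * caterpillarCount (m + n))
  ≤⟨ +-mono-≤ (2≤caterpillarCount n) (*-monoʳ-≤ 2 (2*caterpillarCount-+≤* m n)) ⟩
    caterpillarCount n + 2 * (caterpillarCount m * caterpillarCount n)
  ≡⟨ cong (caterpillarCount n +_) (*-assoc 2 (caterpillarCount m) (caterpillarCount n)) ⟨
    suc (2 * caterpillarCount m) * caterpillarCount n
  ∎
  where open ≤-Reasoning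

caterpillarCount≤closedCount : (t : BTree) → caterpillarCount (internal t) ≤ closedCount t
caterpillarCount≤closedCount leaf       = ≤-refl
caterpillarCount≤closedCount (node l r) = begin
    suc (2 * caterpillarCount (internal l + internal r))
  ≤⟨ s≤s (2*caterpillarCount-+≤* (internal l) (internal r)) ⟩
    suc (caterpillarCount (internal l) * caterpillarCount (internal r))
  ≤⟨ s≤s (*-mono-≤ (caterpillarCount≤closedCount l) (caterpillarCount≤closedCount r)) ⟩
    suc (closedCount l * closedCount r)
  ≡⟨ +-comm 1 _ ⟩
    closedCount l * closedCount r + 1
  ≡⟨ closedCount-node l r ⟨
    closedCount (node l r)
  ∎
  where open ≤-Reasoning

internal-injective-size : {s t : BTree} → size s ≡ size t → internal s ≡ internal t
internal-injective-size {s} {t} eq =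
  *-cancelˡ-≡ (internal s) (internal t) 2
    (suc-injective (trans (sym (size≡1+2*internal s)) (trans eq (size≡1+2*internal t))))

proposition2p4 : (N : ℕ) → 1 ≤ N →
    ((T : BTree) → size T ≡ N → Σ BTree (λ C → IsCaterpillar C × size C ≡ N))
    × ((C T : BTree) → IsCaterpillar C → size C ≡ N → size T ≡ N → F-root C ≤ F-root T)
proposition2p4 N _ = caterpillar-exists , caterpillar-minimal
  where
  caterpillar-exists : (T : BTree) → size T ≡ N → Σ BTree (λ C → IsCaterpillar C × size C ≡ N)
  caterpillar-exists T eq = caterpillar (internal T) , caterpillar-isCaterpillar (internal T) ,
    trans (size-caterpillar (internal T)) (trans (sym (size≡1+2*internal T)) eq)
  caterpillar-minimal : (C T : BTree) → IsCaterpillar C → size C ≡ N → size T ≡ N → F-root C ≤ F-root T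
  caterpillar-minimal C T isCat eqC eqT = s≤s⁻¹ (begin
      suc (F-root C)              ≡⟨ closedCount≡suc-F-root C ⟨
      closedCount C               ≡⟨ closedCount-caterpillar isCat ⟩
      caterpillarCount (internal C) ≡⟨ cong caterpillarCount (internal-injective-size (trans eqC (sym eqT))) ⟩
      caterpillarCount (internal T) ≤⟨ caterpillarCount≤closedCount T ⟩
      closedCount T               ≡⟨ closedCount≡suc-F-root T ⟩
      suc (F-root T)              ∎)
    where open ≤-Reasoning
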